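{- Let $\mathcal{F}$ be a non-trivial monotone left-compressed $t$-intersecting family on $n$ points with extent $m>1$, generating family $\mathcal{G}$, and boundary generating family $\mathcal{G}^*$. Suppose that $a = \frac{m+t}{2}$ is an integer and that $\mathcal{G}^*_a$ is non-empty. For each $i \in [m-1]$, let $\mathcal{G}^*_{a,i} = \{ S \in \mathcal{G}^*_a : i \in S \}$, let \[ \mathcal{G}_i = (\mathcal{G} \setminus \mathcal{G}^*_a) \cup \{ S \setminus \{m\} : S \in \mathcal{G}^*_a \setminus \mathcal{G}^*_{a,i} \}, \] and let $\mathcal{F}_i$ be the up-set of $\mathcal{G}_i$ within $2^{[n]}$. Then all families $\mathcal{F}_i$ are $t$-intersecting. Moreover, if $0<p < \frac{m-t}{2(m-1)}$ then $\mu_p(\mathcal{F}_i) > \mu_p(\mathcal{F})$ for some $i \in [m-1]$.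
   Context: A family on $n$ points is a collection of subsets of $[n]$; $t$-intersecting: any two members share at least $t$ elements; monotone: closed under supersets within $[n]$; non-trivial: neither $\emptyset$ nor $2^{[n]}$; left-compressed: $A\in\mathcal{F}$, $i\in A$, $j\notin A$, $j<i$ imply $(A\setminus\{i\})\cup\{j\}\in\mathcal{F}$. For non-trivial monotone $\mathcal{F}$: a generating set is a member of $\mathcal{F}$ with no proper subset in $\mathcal{F}$; the generating family $\mathcal{G}$ is the set of generating sets; the extent is the largest element appearing in a generating set; the boundary generating family $\mathcal{G}^*$ is the set of generating sets containing the extent; $\mathcal{G}^*_a$ denotes the sets in $\mathcal{G}^*$ of size $a$. The up-set of $\mathcal{H}$ is $\{B\subseteq[n] : B\supseteq A \text{ for some } A\in\mathcal{H}\}$. $\mu_p(A) = p^{|A|}(1-p)^{n-|A|}$, $\mu_p(\mathcal{F})=\sum_{A\in\mathcal{F}}\mu_p(A)$.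
   Formalization: The parameter p in the bound $\mu_p(\mathcal{F}_i) > \mu_p(\mathcal{F})$ ranges only over the rationals instead of the reals. -}

module Defs where

open import Data.Bool using (Bool; true; false; _∧_; _∨_; not; if_then_else_)
import Data.Bool as Bool
open import Data.Nat using (ℕ; zero; suc; _∸_; _≤_; _<_; _≡ᵇ_)
open import Data.Fin using (Fin; toℕ)
open import Data.Fin.Subset using (Subset; _∈_; _∉_; _⊆_; _∩_; _∪_; ∣_∣; _-_; ⁅_⁆)
open import Data.Fin.Subset.Properties using (_⊆?_; _∈?_)
open import Data.Vec using (Vec; []; _∷_)
open import Data.Vec.Properties using (≡-dec)
open import Data.List using (List; map; _++_; foldr)
open import Data.Bool.ListAction using (all; any)
import Data.List as List
open import Data.Integer using (+_)
open import Data.Rational using (ℚ; 0ℚ; 1ℚ; _+_; _*_; _/_)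
open import Relation.Nullary.Decidable using (⌊_⌋)
open import Relation.Binary.PropositionalEquality using (_≡_)
open import Data.Product using (_×_; ∃)

-- Points [n] = {1,…,n} are represented by Fin n, point k ↦ index k-1
-- (so the order is preserved).
Family : ℕ → Set
Family n = Subset n → Bool

allSubsets : (n : ℕ) → List (Subset n)
allSubsets zero = List.[ [] ]
allSubsets (suc n) = map (true ∷_) (allSubsets n) ++ map (false ∷_) (allSubsets n)

ℕ→ℚ : ℕ → ℚ
ℕ→ℚ k = + k / 1

_^ℚ_ : ℚ → ℕ → ℚ
x ^ℚ zero = 1ℚ
x ^ℚ suc k = x * (x ^ℚ k)

module _ {n : ℕ} where

  TIntersecting : ℕ → Family n → Set
  TIntersecting t F = ∀ A B → F A ≡ true → F B ≡ true → t ≤ ∣ A ∩ B ∣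

  Monotone : Family n → Set
  Monotone F = ∀ A B → A ⊆ B → F A ≡ true → F B ≡ true

  NonTrivial : Family n → Set
  NonTrivial F = (∃ λ A → F A ≡ true) × (∃ λ A → F A ≡ false)

  LeftCompressed : Family n → Set
  LeftCompressed F = ∀ A (i j : Fin n) → F A ≡ true → i ∈ A → j ∉ A →
    toℕ j < toℕ i → F ((A - i) ∪ ⁅ j ⁆) ≡ true

  properSubsetᵇ : Subset n → Subset n → Bool
  properSubsetᵇ B A = ⌊ B ⊆? A ⌋ ∧ not ⌊ ≡-dec Bool._≟_ B A ⌋

  isGen : Family n → Subset n → Bool
  isGen F S = F S ∧ all (λ B → not (properSubsetᵇ B S ∧ F B)) (allSubsets n)

  -- the extent of F is the point e (0-based index; extent m = toℕ e + 1):
  -- e occurs in some generating set, and every element of every generating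
  -- set is ≤ e.
  IsExtent : Family n → Fin n → Set
  IsExtent F e = (∃ λ S → isGen F S ≡ true × e ∈ S)
               × (∀ S x → isGen F S ≡ true → x ∈ S → toℕ x ≤ toℕ e)

  GStarₐ : Family n → Fin n → ℕ → Subset n → Bool
  GStarₐ F e a S = isGen F S ∧ ⌊ e ∈? S ⌋ ∧ (∣ S ∣ ≡ᵇ a)

  Gᵢ : Family n → Fin n → ℕ → Fin n → Subset n → Bool
  Gᵢ F e a i A = (isGen F A ∧ not (GStarₐ F e a A))
    ∨ any (λ S → GStarₐ F e a S ∧ not ⌊ i ∈? S ⌋ ∧ ⌊ ≡-dec Bool._≟_ A (S - e) ⌋)
          (allSubsets n)

  Fᵢ : Family n → Fin n → ℕ → Fin n → Family n
  Fᵢ F e a i B = any (λ A → Gᵢ F e a i A ∧ ⌊ A ⊆? B ⌋) (allSubsets n)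

  μ : ℚ → Family n → ℚ
  μ p F = foldr _+_ 0ℚ
    (map (λ A → if F A then (p ^ℚ ∣ A ∣) * ((1ℚ Data.Rational.- p) ^ℚ (n ∸ ∣ A ∣)) else 0ℚ)
         (allSubsets n))

-- Points are 0-based, so the extent m is the point e with toℕ e = m - 1, and [m - 1] is ⁅< e ⁆.
--
-- For trimmed sets S - m and T - m (S, T ∈ G*_a, i ∉ S, T),
-- left compression puts (S - m) ∪ {i} into F, and it meets T only inside T - m.  A kept generator
-- A ∋ m meets T - m in t points by the same compression with some j < m outside A ∪ T; if there
-- is no such j then A ∪ T = [m], so |A ∩ T| = |A| + a - m ≥ t, and |A| ≠ a makes this strict.
--
-- For the measures, sum μ_p(Fᵢ) over i ∈ [m - 1] and compare with (m - 1) μ_p(F), pairing each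
-- A ∌ m with A ∪ {m}.  If (A ∩ [m - 1]) ∪ {m} is not in G*_a, every Fᵢ contains F on the pair.
-- Otherwise it is some S ∈ G*_a: F contains A ∪ {m} but not A, while Fᵢ contains both exactly
-- when i ∉ A, which happens for m - a = (m - t)/2 indices i.  Writing μ_p(A) = (1 - p) q and
-- μ_p(A ∪ {m}) = p q, the pair contributes (m - 1) p q to the first sum and (m - t) q / 2 to the
-- second, strictly more when p < (m - t) / (2(m - 1)); G*_a ≠ ∅ supplies one such pair.
module Submission where

open import Defs
open import Data.Bool using (Bool; true; false; _∧_; _∨_; not; if_then_else_)
import Data.Bool as Bool
open import Data.Bool.ListAction using (all; any)
open import Data.Bool.Properties using (T-≡; ∨-zeroʳ)
open import Data.Empty using (⊥-elim)
open import Data.Fin using (Fin; toℕ) renaming (zero to fzero; suc to fsuc)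
import Data.Fin.Properties as Fin
open import Data.Fin.Subset
open import Data.Fin.Subset.Properties
import Data.Integer as ℤ
import Data.Integer.Properties as ℤ
open import Data.List using (List; map; _++_; foldr)
import Data.List as List
open import Data.List.Properties using (map-∘)
open import Data.List.Membership.Propositional using (lose) renaming (_∈_ to _∈ₗ_)
open import Data.List.Membership.Propositional.Properties using (∈-map⁺; ∈-++⁺ˡ; ∈-++⁺ʳ)
import Data.List.Relation.Unary.Any as Any
open import Data.List.Relation.Unary.Any.Properties using (any⁺; any⁻)
open import Data.Nat as ℕ using (ℕ; zero; suc; _+_; _*_; _∸_; _<_; _≤_; z≤n; s≤s)
import Data.Nat.Properties as ℕ
open import Data.Product using (_×_; ∃; _,_; proj₁; proj₂)
import Data.Product as Product
open import Data.Rational using (ℚ; 0ℚ; 1ℚ) renaming (_<_ to _<ℚ_; _*_ to _*ℚ_; _-_ to _-ℚ_)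
import Data.Rational as ℚ
import Data.Rational.Properties as ℚ
open import Data.Rational.Solver using (module +-*-Solver)
open +-*-Solver using (solve; _:+_; _:*_; _:-_; _:=_; con)
import Data.Rational.Unnormalised as ℚᵘ
import Data.Rational.Unnormalised.Properties as ℚᵘ
open import Data.Sum using (_⊎_; inj₁; inj₂; [_,_]′)
open import Data.Vec using ([]; _∷_; here; there; lookup; _[_]≔_)
open import Data.Vec.Properties
  using (≡-dec; []=⇒lookup; lookup⇒[]=; []≔-updates; lookup-map; lookup-replicate)
open import Function using (_∘_; Equivalence)
open import Relation.Binary.PropositionalEquality
open import Relation.Nullary using (¬_; Dec; yes; no; contradiction; ¬?; _×-dec_; _→-dec_)
open import Relation.Nullary.Decidable using (⌊_⌋; isYes≗does; dec-true; dec-false)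

private
  variable
    n : ℕ

∧-true⁻ : ∀ {x y} → x ∧ y ≡ true → x ≡ true × y ≡ true
∧-true⁻ {true} y≡true = refl , y≡true

∧-false⁻ : ∀ {x y} → x ≡ true → x ∧ y ≡ false → y ≡ false
∧-false⁻ refl x∧y≡false = x∧y≡false

not-true⁻ : ∀ {x} → not x ≡ true → x ≡ false
not-true⁻ {false} _ = refl

not-false⁻ : ∀ {x} → not x ≡ false → x ≡ true
not-false⁻ {true} _ = refl

true≢false : ∀ {x} → x ≡ true → x ≢ false
true≢false refl ()

⌊⌋-true⁻ : ∀ {P : Set} (P? : Dec P) → ⌊ P? ⌋ ≡ true → P
⌊⌋-true⁻ (yes p) _ = p

⌊⌋-false⁻ : ∀ {P : Set} (P? : Dec P) → ⌊ P? ⌋ ≡ false → ¬ P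
⌊⌋-false⁻ (no ¬p) _ = ¬p

⌊⌋-true⁺ : ∀ {P : Set} (P? : Dec P) → P → ⌊ P? ⌋ ≡ true
⌊⌋-true⁺ P? p = trans (isYes≗does P?) (dec-true P? p)

⌊⌋-false⁺ : ∀ {P : Set} (P? : Dec P) → ¬ P → ⌊ P? ⌋ ≡ false
⌊⌋-false⁺ P? ¬p = trans (isYes≗does P?) (dec-false P? ¬p)

module _ {A : Set} (P : A → Bool) where

  any-true⁻ : ∀ xs → any P xs ≡ true → ∃ λ x → P x ≡ true
  any-true⁻ xs h =
    Product.map₂ (Equivalence.to T-≡) (Any.satisfied (any⁻ P xs (Equivalence.from T-≡ h)))

  any-true⁺ : ∀ {xs x} → x ∈ₗ xs → P x ≡ true → any P xs ≡ true
  any-true⁺ x∈xs Px = Equivalence.to T-≡ (any⁺ P (lose x∈xs (Equivalence.from T-≡ Px)))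

  all-true⁻ : ∀ {xs x} → all P xs ≡ true → x ∈ₗ xs → P x ≡ true
  all-true⁻ h (Any.here refl) = proj₁ (∧-true⁻ h)
  all-true⁻ {y List.∷ _} h (Any.there x∈xs) = all-true⁻ (proj₂ (∧-true⁻ {P y} h)) x∈xs

  all-false⁻ : ∀ xs → all P xs ≡ false → ∃ λ x → P x ≡ false
  all-false⁻ (x List.∷ xs) h with P x in Px
  ... | false = x , Px
  ... | true  = all-false⁻ xs h

∈-allSubsets : (A : Subset n) → A ∈ₗ allSubsets n
∈-allSubsets []            = Any.here refl
∈-allSubsets (true  ∷ A)   = ∈-++⁺ˡ (∈-map⁺ (true ∷_) (∈-allSubsets A))
∈-allSubsets {suc n} (false ∷ A) =
  ∈-++⁺ʳ (map (true ∷_) (allSubsets n)) (∈-map⁺ (false ∷_) (∈-allSubsets A))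

x∈p─q⇒x∉q : ∀ {x} (p q : Subset n) → x ∈ p ─ q → x ∉ q
x∈p─q⇒x∉q (_ ∷ p) (true  ∷ q) (there x∈) (there x∈q) = x∈p─q⇒x∉q p q x∈ x∈q
x∈p─q⇒x∉q (_ ∷ p) (false ∷ q) (there x∈) (there x∈q) = x∈p─q⇒x∉q p q x∈ x∈q

x∈p-y⁻ : ∀ {x y} {p : Subset n} → x ∈ p - y → x ∈ p × x ≢ y
x∈p-y⁻ {y = y} {p} x∈ =
  p─q⊆p p ⁅ y ⁆ x∈ , λ { refl → x∈p─q⇒x∉q p ⁅ y ⁆ x∈ (x∈⁅x⁆ y) }

x∉p-x : ∀ {x} (p : Subset n) → x ∉ p - x
x∉p-x p x∈ = proj₂ (x∈p-y⁻ x∈) refl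

p⊆q∧p≢q⇒∣p∣<∣q∣ : ∀ {p q : Subset n} → p ⊆ q → p ≢ q → ∣ p ∣ < ∣ q ∣
p⊆q∧p≢q⇒∣p∣<∣q∣ {n} {p} {q} p⊆q p≢q with
  Fin.¬∀⟶∃¬ n (λ x → x ∈ q → x ∈ p) (λ x → x ∈? q →-dec x ∈? p)
            (λ q⊆p → p≢q (⊆-antisym p⊆q (q⊆p _)))
... | x , ¬[x∈q→x∈p] with x ∈? q
...   | yes x∈q = p⊂q⇒∣p∣<∣q∣ (p⊆q , x , x∈q , λ x∈p → ¬[x∈q→x∈p] (λ _ → x∈p))
...   | no  x∉q = contradiction (λ x∈q → contradiction x∈q x∉q) ¬[x∈q→x∈p]

∣p∪q∣+∣p∩q∣≡∣p∣+∣q∣ : (p q : Subset n) → ∣ p ∪ q ∣ + ∣ p ∩ q ∣ ≡ ∣ p ∣ + ∣ q ∣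
∣p∪q∣+∣p∩q∣≡∣p∣+∣q∣ []          []          = refl
∣p∪q∣+∣p∩q∣≡∣p∣+∣q∣ (true  ∷ p) (true  ∷ q) =
  cong suc (trans (ℕ.+-suc _ _) (trans (cong suc (∣p∪q∣+∣p∩q∣≡∣p∣+∣q∣ p q)) (sym (ℕ.+-suc _ _))))
∣p∪q∣+∣p∩q∣≡∣p∣+∣q∣ (true  ∷ p) (false ∷ q) = cong suc (∣p∪q∣+∣p∩q∣≡∣p∣+∣q∣ p q)
∣p∪q∣+∣p∩q∣≡∣p∣+∣q∣ (false ∷ p) (true  ∷ q) =
  trans (cong suc (∣p∪q∣+∣p∩q∣≡∣p∣+∣q∣ p q)) (sym (ℕ.+-suc _ _))
∣p∪q∣+∣p∩q∣≡∣p∣+∣q∣ (false ∷ p) (false ∷ q) = ∣p∪q∣+∣p∩q∣≡∣p∣+∣q∣ p q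

∣p∩q∣+∣p∩∁q∣≡∣p∣ : (p q : Subset n) → ∣ p ∩ q ∣ + ∣ p ∩ ∁ q ∣ ≡ ∣ p ∣
∣p∩q∣+∣p∩∁q∣≡∣p∣ []          []          = refl
∣p∩q∣+∣p∩∁q∣≡∣p∣ (true  ∷ p) (true  ∷ q) = cong suc (∣p∩q∣+∣p∩∁q∣≡∣p∣ p q)
∣p∩q∣+∣p∩∁q∣≡∣p∣ (true  ∷ p) (false ∷ q) = trans (ℕ.+-suc _ _) (cong suc (∣p∩q∣+∣p∩∁q∣≡∣p∣ p q))
∣p∩q∣+∣p∩∁q∣≡∣p∣ (false ∷ p) (_     ∷ q) = ∣p∩q∣+∣p∩∁q∣≡∣p∣ p q

x∈p[x]≔true : ∀ (p : Subset n) x → x ∈ p [ x ]≔ true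
x∈p[x]≔true p x = []≔-updates p x

p⊆p[x]≔true : ∀ (p : Subset n) x → p ⊆ p [ x ]≔ true
p⊆p[x]≔true (_ ∷ p) fzero    here        = here
p⊆p[x]≔true (_ ∷ p) fzero    (there y∈p) = there y∈p
p⊆p[x]≔true (_ ∷ p) (fsuc x) here        = here
p⊆p[x]≔true (_ ∷ p) (fsuc x) (there y∈p) = there (p⊆p[x]≔true p x y∈p)

∈-[]≔true⁻ : ∀ {y} (p : Subset n) x → y ∈ p [ x ]≔ true → y ∈ p ⊎ y ≡ x
∈-[]≔true⁻ (_ ∷ p) fzero    here        = inj₂ refl
∈-[]≔true⁻ (_ ∷ p) fzero    (there y∈p) = inj₁ (there y∈p)
∈-[]≔true⁻ (_ ∷ p) (fsuc x) here        = inj₁ here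
∈-[]≔true⁻ (_ ∷ p) (fsuc x) (there y∈)  with ∈-[]≔true⁻ p x y∈
... | inj₁ y∈p  = inj₁ (there y∈p)
... | inj₂ refl = inj₂ refl

lookup≡false⇒∉ : ∀ {x} {p : Subset n} → lookup p x ≡ false → x ∉ p
lookup≡false⇒∉ px≡false x∈p = true≢false ([]=⇒lookup x∈p) px≡false

∉⇒lookup≡false : ∀ {x} {p : Subset n} → x ∉ p → lookup p x ≡ false
∉⇒lookup≡false {x = x} {p} x∉p with lookup p x in px
... | false = refl
... | true  = contradiction (lookup⇒[]= x p px) x∉p

x∉p⇒∣p[x]≔true∣≡1+∣p∣ : ∀ {x} (p : Subset n) → x ∉ p → ∣ p [ x ]≔ true ∣ ≡ suc ∣ p ∣
x∉p⇒∣p[x]≔true∣≡1+∣p∣ {x = fzero}  (true  ∷ p) x∉p = contradiction here x∉p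
x∉p⇒∣p[x]≔true∣≡1+∣p∣ {x = fzero}  (false ∷ p) x∉p = refl
x∉p⇒∣p[x]≔true∣≡1+∣p∣ {x = fsuc x} (true  ∷ p) x∉p =
  cong suc (x∉p⇒∣p[x]≔true∣≡1+∣p∣ p (x∉p ∘ there))
x∉p⇒∣p[x]≔true∣≡1+∣p∣ {x = fsuc x} (false ∷ p) x∉p = x∉p⇒∣p[x]≔true∣≡1+∣p∣ p (x∉p ∘ there)

p⊆[p-x][x]≔true : ∀ (p : Subset n) x → p ⊆ (p - x) [ x ]≔ true
p⊆[p-x][x]≔true p x {y} y∈p with y Fin.≟ x
... | yes refl = x∈p[x]≔true (p - x) x
... | no  y≢x  = p⊆p[x]≔true (p - x) x (x∈p∧x≢y⇒x∈p-y y∈p y≢x)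

∣p∣≤1+∣p-x∣ : ∀ (p : Subset n) x → ∣ p ∣ ≤ suc ∣ p - x ∣
∣p∣≤1+∣p-x∣ p x = ℕ.≤-trans (p⊆q⇒∣p∣≤∣q∣ (p⊆[p-x][x]≔true p x))
                            (ℕ.≤-reflexive (x∉p⇒∣p[x]≔true∣≡1+∣p∣ (p - x) (x∉p-x p)))

⁅<_⁆ : Fin n → Subset n
⁅< fzero  ⁆ = ⊥
⁅< fsuc e ⁆ = inside ∷ ⁅< e ⁆

∈⁅<⁆⁺ : ∀ {x e : Fin n} → toℕ x < toℕ e → x ∈ ⁅< e ⁆
∈⁅<⁆⁺ {x = fzero}  {fsuc e} _         = here
∈⁅<⁆⁺ {x = fsuc x} {fsuc e} (s≤s x<e) = there (∈⁅<⁆⁺ x<e)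

∈⁅<⁆⁻ : ∀ {x e : Fin n} → x ∈ ⁅< e ⁆ → toℕ x < toℕ e
∈⁅<⁆⁻ {x = x}      {fzero}  x∈⊥         = contradiction x∈⊥ ∉⊥
∈⁅<⁆⁻ {x = fzero}  {fsuc e} here        = s≤s z≤n
∈⁅<⁆⁻ {x = fsuc x} {fsuc e} (there x∈) = s≤s (∈⁅<⁆⁻ x∈)

∣⁅<e⁆∣≡e : (e : Fin n) → ∣ ⁅< e ⁆ ∣ ≡ toℕ e
∣⁅<e⁆∣≡e {suc n} fzero    = ∣⊥∣≡0 (suc n)
∣⁅<e⁆∣≡e         (fsuc e) = cong suc (∣⁅<e⁆∣≡e e)

truncateAt : Fin n → Subset n → Subset n
truncateAt e C = (⁅< e ⁆ ∩ C) [ e ]≔ true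

module _ {e : Fin n} {C : Subset n} where

  e∈truncateAt : e ∈ truncateAt e C
  e∈truncateAt = x∈p[x]≔true (⁅< e ⁆ ∩ C) e

  e∉⁅<e⁆∩C : e ∉ ⁅< e ⁆ ∩ C
  e∉⁅<e⁆∩C e∈ = ℕ.<-irrefl refl (∈⁅<⁆⁻ (proj₁ (x∈p∩q⁻ _ _ e∈)))

  ∈-truncateAt⁺ : ∀ {x} → toℕ x < toℕ e → x ∈ C → x ∈ truncateAt e C
  ∈-truncateAt⁺ x<e x∈C = p⊆p[x]≔true (⁅< e ⁆ ∩ C) e (x∈p∩q⁺ (∈⁅<⁆⁺ x<e , x∈C))

  ∈-truncateAt⁻ : ∀ {x} → x ∈ truncateAt e C → x ≡ e ⊎ (toℕ x < toℕ e × x ∈ C)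
  ∈-truncateAt⁻ x∈ with ∈-[]≔true⁻ (⁅< e ⁆ ∩ C) e x∈
  ... | inj₂ x≡e = inj₁ x≡e
  ... | inj₁ x∈⁅<e⁆∩C = inj₂ (Product.map₁ ∈⁅<⁆⁻ (x∈p∩q⁻ _ _ x∈⁅<e⁆∩C))

  ∣truncateAt∣ : ∣ truncateAt e C ∣ ≡ suc ∣ ⁅< e ⁆ ∩ C ∣
  ∣truncateAt∣ = x∉p⇒∣p[x]≔true∣≡1+∣p∣ (⁅< e ⁆ ∩ C) e∉⁅<e⁆∩C

  ⊆-truncateAt : ∀ {R} → (∀ {x} → x ∈ R → toℕ x ≤ toℕ e) →
                 (∀ {x} → x ∈ R → toℕ x < toℕ e → x ∈ C) → R ⊆ truncateAt e C
  ⊆-truncateAt {R} bounded below {x} x∈R with ℕ.m≤n⇒m<n∨m≡n (bounded x∈R)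
  ... | inj₁ x<e = ∈-truncateAt⁺ x<e (below x∈R x<e)
  ... | inj₂ x≡e rewrite Fin.toℕ-injective x≡e = e∈truncateAt

⁅<e⁆∩p[e]≔true : ∀ (e : Fin n) p → ⁅< e ⁆ ∩ (p [ e ]≔ true) ≡ ⁅< e ⁆ ∩ p
⁅<e⁆∩p[e]≔true fzero    (_ ∷ p) = refl
⁅<e⁆∩p[e]≔true (fsuc e) (_ ∷ p) = cong (_ ∷_) (⁅<e⁆∩p[e]≔true e p)

truncateAt-[]≔true : ∀ (e : Fin n) p → truncateAt e (p [ e ]≔ true) ≡ truncateAt e p
truncateAt-[]≔true e p = cong (_[ e ]≔ true) (⁅<e⁆∩p[e]≔true e p)

properSubsetᵇ⁺ : ∀ {B S : Subset n} → B ⊆ S → B ≢ S → properSubsetᵇ B S ≡ true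
properSubsetᵇ⁺ {B = B} {S} B⊆S B≢S
  rewrite ⌊⌋-true⁺ (B ⊆? S) B⊆S | ⌊⌋-false⁺ (≡-dec Bool._≟_ B S) B≢S = refl

properSubsetᵇ⁻ : ∀ {B S : Subset n} → properSubsetᵇ B S ≡ true → B ⊆ S × B ≢ S
properSubsetᵇ⁻ {B = B} {S} h with ∧-true⁻ h
... | B⊆S , B≢S = ⌊⌋-true⁻ (B ⊆? S) B⊆S , ⌊⌋-false⁻ (≡-dec Bool._≟_ B S) (not-true⁻ B≢S)

module Generators {n : ℕ} (F : Family n) where

  isGen⇒∈ : ∀ {S} → isGen F S ≡ true → F S ≡ true
  isGen⇒∈ = proj₁ ∘ ∧-true⁻

  isGen⇒minimal : ∀ {S B} → isGen F S ≡ true → B ⊆ S → B ≢ S → F B ≡ false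
  isGen⇒minimal {S} {B} gS B⊆S B≢S = not-true⁻
    (subst (λ b → not (b ∧ F B) ≡ true) (properSubsetᵇ⁺ B⊆S B≢S)
           (all-true⁻ _ (proj₂ (∧-true⁻ {F S} gS)) (∈-allSubsets B)))

  isGen-⊆⇒≡ : ∀ {S T} → isGen F S ≡ true → isGen F T ≡ true → T ⊆ S → T ≡ S
  isGen-⊆⇒≡ {S} {T} gS gT T⊆S with ≡-dec Bool._≟_ T S
  ... | yes T≡S = T≡S
  ... | no  T≢S = contradiction (isGen⇒minimal gS T⊆S T≢S) (true≢false (isGen⇒∈ gT))

  ∃isGen-⊆ : ∀ {A} → F A ≡ true → ∃ λ S → S ⊆ A × isGen F S ≡ true
  ∃isGen-⊆ = descend _ ℕ.≤-refl
    where
    descend : ∀ k {A} → ∣ A ∣ < k → F A ≡ true → ∃ λ S → S ⊆ A × isGen F S ≡ true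
    descend (suc k) {A} ∣A∣<1+k FA with isGen F A in gA
    ... | true  = A , ⊆-refl , gA
    ... | false with all-false⁻ _ (allSubsets n) (∧-false⁻ FA gA)
    ...   | B , B⊂A∧FB with ∧-true⁻ (not-false⁻ B⊂A∧FB)
    ...     | B⊂A , FB with properSubsetᵇ⁻ B⊂A
    ...       | B⊆A , B≢A with descend k (ℕ.≤-trans (p⊆q∧p≢q⇒∣p∣<∣q∣ B⊆A B≢A) (ℕ.≤-pred ∣A∣<1+k)) FB
    ...         | S , S⊆B , gS = S , ⊆-trans S⊆B B⊆A , gS

module Modification {n : ℕ} (F : Family n) (e : Fin n) (a : ℕ) where
  open Generators F

  IsBoundaryₐ : Subset n → Set
  IsBoundaryₐ S = isGen F S ≡ true × e ∈ S × ∣ S ∣ ≡ a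

  GStarₐ⁻ : ∀ {S} → GStarₐ F e a S ≡ true → IsBoundaryₐ S
  GStarₐ⁻ {S} h with ∧-true⁻ h
  ... | gS , rest with ∧-true⁻ rest
  ...   | e∈S , ∣S∣≡a =
    gS , ⌊⌋-true⁻ (e ∈? S) e∈S , ℕ.≡ᵇ⇒≡ ∣ S ∣ a (Equivalence.from T-≡ ∣S∣≡a)

  GStarₐ⁺ : ∀ {S} → IsBoundaryₐ S → GStarₐ F e a S ≡ true
  GStarₐ⁺ {S} (gS , e∈S , ∣S∣≡a)
    rewrite gS | ⌊⌋-true⁺ (e ∈? S) e∈S = Equivalence.to T-≡ (ℕ.≡⇒≡ᵇ ∣ S ∣ a ∣S∣≡a)

  GStarₐ-false⁺ : ∀ {S} → ¬ IsBoundaryₐ S → GStarₐ F e a S ≡ false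
  GStarₐ-false⁺ {S} ¬bS with GStarₐ F e a S in h
  ... | false = refl
  ... | true  = contradiction (GStarₐ⁻ h) ¬bS

  module _ (i : Fin n) where

    Gᵢ⁻ : ∀ {A} → Gᵢ F e a i A ≡ true →
          (isGen F A ≡ true × ¬ IsBoundaryₐ A) ⊎ (∃ λ S → IsBoundaryₐ S × i ∉ S × A ≡ S - e)
    Gᵢ⁻ {A} h with isGen F A ∧ not (GStarₐ F e a A) in kept
    ... | true with ∧-true⁻ kept
    ...   | gA , ¬bA = inj₁ (gA , λ bA → true≢false (GStarₐ⁺ bA) (not-true⁻ ¬bA))
    Gᵢ⁻ {A} h | false with any-true⁻ _ (allSubsets n) h
    ...   | S , trimmed with ∧-true⁻ trimmed
    ...     | bS , rest with ∧-true⁻ rest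
    ...       | i∉S , A≡S-e =
      inj₂ (S , GStarₐ⁻ bS , ⌊⌋-false⁻ (i ∈? S) (not-true⁻ i∉S) ,
                ⌊⌋-true⁻ (≡-dec Bool._≟_ A (S - e)) A≡S-e)

    Gᵢ-kept : ∀ {A} → isGen F A ≡ true → ¬ IsBoundaryₐ A → Gᵢ F e a i A ≡ true
    Gᵢ-kept {A} gA ¬bA rewrite GStarₐ-false⁺ {A} ¬bA | gA = refl

    Gᵢ-trimmed : ∀ {S} → IsBoundaryₐ S → i ∉ S → Gᵢ F e a i (S - e) ≡ true
    Gᵢ-trimmed {S} bS i∉S =
      subst (λ b → isGen F (S - e) ∧ not (GStarₐ F e a (S - e)) ∨ b ≡ true)
            (sym (any-true⁺ _ (∈-allSubsets S) witness)) (∨-zeroʳ _)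
      where
      witness : (GStarₐ F e a S ∧ not ⌊ i ∈? S ⌋ ∧ ⌊ ≡-dec Bool._≟_ (S - e) (S - e) ⌋) ≡ true
      witness rewrite GStarₐ⁺ bS | ⌊⌋-false⁺ (i ∈? S) i∉S
                    | ⌊⌋-true⁺ (≡-dec Bool._≟_ (S - e) (S - e)) refl = refl

    Fᵢ⁺ : ∀ {A B} → Gᵢ F e a i A ≡ true → A ⊆ B → Fᵢ F e a i B ≡ true
    Fᵢ⁺ {A} {B} gA A⊆B =
      any-true⁺ _ (∈-allSubsets A) (subst (λ b → b ∧ _ ≡ true) (sym gA) (⌊⌋-true⁺ (A ⊆? B) A⊆B))

    Fᵢ⁻ : ∀ {B} → Fᵢ F e a i B ≡ true → ∃ λ A → Gᵢ F e a i A ≡ true × A ⊆ B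
    Fᵢ⁻ {B} h with any-true⁻ _ (allSubsets n) h
    ... | A , gA∧A⊆B with ∧-true⁻ gA∧A⊆B
    ...   | gA , A⊆B = A , gA , ⌊⌋-true⁻ (A ⊆? B) A⊆B

    Fᵢ-monotone : ∀ {B C} → B ⊆ C → Fᵢ F e a i B ≡ true → Fᵢ F e a i C ≡ true
    Fᵢ-monotone B⊆C h with Fᵢ⁻ h
    ... | A , gA , A⊆B = Fᵢ⁺ gA (⊆-trans A⊆B B⊆C)

module _ {n t : ℕ} {F : Family n} (lc : LeftCompressed F) (ti : TIntersecting t F) where

  -- Moving e down to a point j outside both sets keeps A in F without creating a common element.
  compressed-∩ : ∀ {A B e j} → F A ≡ true → e ∈ A → j ∉ A → toℕ j < toℕ e →
                 F B ≡ true → j ∉ B → t ≤ ∣ (A - e) ∩ (B - e) ∣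
  compressed-∩ {A} {B} {e} {j} FA e∈A j∉A j<e FB j∉B =
    ℕ.≤-trans (ti _ B (lc A e j FA e∈A j∉A j<e) FB) (p⊆q⇒∣p∣≤∣q∣ shrink)
    where
    shrink : ((A - e) ∪ ⁅ j ⁆) ∩ B ⊆ (A - e) ∩ (B - e)
    shrink x∈ with x∈p∩q⁻ _ B x∈
    ... | x∈A-e∪j , x∈B with x∈p∪q⁻ (A - e) ⁅ j ⁆ x∈A-e∪j
    ...   | inj₂ x∈⁅j⁆ rewrite x∈⁅y⁆⇒x≡y j x∈⁅j⁆ = contradiction x∈B j∉B
    ...   | inj₁ x∈A-e = x∈p∩q⁺ (x∈A-e , x∈p∧x≢y⇒x∈p-y x∈B (proj₂ (x∈p-y⁻ x∈A-e)))

-- By inclusion–exclusion, an overlap of exactly t would force |A| = a.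
overlap-strict : ∀ {m t a s k} → m + t ≡ 2 * a → m + k ≡ s + a → t ≤ k → s ≢ a → t < k
overlap-strict {m} {t} {a} {s} m+t≡2a m+k≡s+a t≤k s≢a with ℕ.m≤n⇒m<n∨m≡n t≤k
... | inj₁ t<k  = t<k
... | inj₂ refl = contradiction
  (ℕ.+-cancelʳ-≡ a s a (trans (sym m+k≡s+a) (trans m+t≡2a (cong (a +_) (ℕ.+-identityʳ a))))) s≢a

module TIntersection {n : ℕ} (t a : ℕ) (F : Family n) (e : Fin n)
  (lc : LeftCompressed F) (ti : TIntersecting t F)
  (bounded : ∀ S x → isGen F S ≡ true → x ∈ S → toℕ x ≤ toℕ e)
  (m+t≡2a : suc (toℕ e) + t ≡ 2 * a) where
  open Generators F
  open Modification F e a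

  ∣A∪T∣≡m : ∀ {A T} → isGen F A ≡ true → isGen F T ≡ true → e ∈ A →
            (∀ {x} → toℕ x < toℕ e → x ∈ A ⊎ x ∈ T) → ∣ A ∪ T ∣ ≡ suc (toℕ e)
  ∣A∪T∣≡m {A} {T} gA gT e∈A covers = begin
    ∣ A ∪ T ∣                 ≡⟨ cong ∣_∣ (⊆-antisym A∪T⊆ ⊆A∪T) ⟩
    ∣ truncateAt e ⊤ ∣        ≡⟨ ∣truncateAt∣ {e = e} {C = ⊤} ⟩
    suc ∣ ⁅< e ⁆ ∩ ⊤ ∣        ≡⟨ cong (suc ∘ ∣_∣) (∩-identityʳ ⁅< e ⁆) ⟩
    suc ∣ ⁅< e ⁆ ∣            ≡⟨ cong suc (∣⁅<e⁆∣≡e e) ⟩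
    suc (toℕ e)               ∎
    where
    open ≡-Reasoning
    A∪T⊆ : A ∪ T ⊆ truncateAt e ⊤
    A∪T⊆ = ⊆-truncateAt (λ {x} x∈ → [ bounded A x gA , bounded T x gT ]′ (x∈p∪q⁻ A T x∈))
                        (λ _ _ → ∈⊤)
    ⊆A∪T : truncateAt e ⊤ ⊆ A ∪ T
    ⊆A∪T x∈ with ∈-truncateAt⁻ x∈
    ... | inj₁ refl       = x∈p∪q⁺ (inj₁ e∈A)
    ... | inj₂ (x<e , _) = x∈p∪q⁺ (covers x<e)

  module _ (i : Fin n) (i<e : toℕ i < toℕ e) where

    trimmed-trimmed : ∀ {S T} → IsBoundaryₐ S → i ∉ S → IsBoundaryₐ T → i ∉ T →
                      t ≤ ∣ (S - e) ∩ (T - e) ∣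
    trimmed-trimmed (gS , e∈S , _) i∉S (gT , _) i∉T =
      compressed-∩ lc ti (isGen⇒∈ gS) e∈S i∉S i<e (isGen⇒∈ gT) i∉T

    kept-trimmed : ∀ {A T} → isGen F A ≡ true → ¬ IsBoundaryₐ A →
                   IsBoundaryₐ T → i ∉ T → t ≤ ∣ A ∩ (T - e) ∣
    kept-trimmed {A} {T} gA ¬bA (gT , e∈T , ∣T∣≡a) i∉T with e ∈? A
    ... | no e∉A =
      ℕ.≤-trans (ti A T (isGen⇒∈ gA) (isGen⇒∈ gT)) (p⊆q⇒∣p∣≤∣q∣ A∩T⊆)
      where
      A∩T⊆ : A ∩ T ⊆ A ∩ (T - e)
      A∩T⊆ x∈ with x∈p∩q⁻ A T x∈
      ... | x∈A , x∈T = x∈p∩q⁺ (x∈A , x∈p∧x≢y⇒x∈p-y x∈T λ { refl → e∉A x∈A })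
    ... | yes e∈A with Fin.any? (λ j → toℕ j ℕ.<? toℕ e ×-dec ¬? (j ∈? A) ×-dec ¬? (j ∈? T))
    ...   | yes (j , j<e , j∉A , j∉T) =
      ℕ.≤-trans (compressed-∩ lc ti (isGen⇒∈ gA) e∈A j∉A j<e (isGen⇒∈ gT) j∉T)
                (p⊆q⇒∣p∣≤∣q∣ (λ x∈ → x∈p∩q⁺ (Product.map₁ (proj₁ ∘ x∈p-y⁻) (x∈p∩q⁻ (A - e) _ x∈))))
    ...   | no no-gap =
      ℕ.≤-pred (ℕ.≤-trans t<∣A∩T∣ (ℕ.≤-trans (∣p∣≤1+∣p-x∣ (A ∩ T) e) (s≤s (p⊆q⇒∣p∣≤∣q∣ A∩T-e⊆))))
      where
      covers : ∀ {x} → toℕ x < toℕ e → x ∈ A ⊎ x ∈ T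
      covers {x} x<e with x ∈? A | x ∈? T
      ... | yes x∈A | _       = inj₁ x∈A
      ... | no  _   | yes x∈T = inj₂ x∈T
      ... | no  x∉A | no  x∉T = contradiction (x , x<e , x∉A , x∉T) no-gap
      A∩T-e⊆ : (A ∩ T) - e ⊆ A ∩ (T - e)
      A∩T-e⊆ x∈ with x∈p-y⁻ x∈
      ... | x∈A∩T , x≢e with x∈p∩q⁻ A T x∈A∩T
      ...   | x∈A , x∈T = x∈p∩q⁺ (x∈A , x∈p∧x≢y⇒x∈p-y x∈T x≢e)
      t<∣A∩T∣ : t < ∣ A ∩ T ∣
      t<∣A∩T∣ = overlap-strict m+t≡2a
        (subst₂ (λ u v → u + ∣ A ∩ T ∣ ≡ ∣ A ∣ + v)
                (∣A∪T∣≡m gA gT e∈A covers) ∣T∣≡a (∣p∪q∣+∣p∩q∣≡∣p∣+∣q∣ A T))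
        (ti A T (isGen⇒∈ gA) (isGen⇒∈ gT))
        (λ ∣A∣≡a → ¬bA (gA , e∈A , ∣A∣≡a))

    Gᵢ-intersecting : ∀ {A B} → Gᵢ F e a i A ≡ true → Gᵢ F e a i B ≡ true → t ≤ ∣ A ∩ B ∣
    Gᵢ-intersecting {A} {B} gA gB with Gᵢ⁻ i gA | Gᵢ⁻ i gB
    ... | inj₁ (gA′ , _) | inj₁ (gB′ , _) = ti A B (isGen⇒∈ gA′) (isGen⇒∈ gB′)
    ... | inj₁ (gA′ , ¬bA) | inj₂ (T , bT , i∉T , refl) = kept-trimmed gA′ ¬bA bT i∉T
    ... | inj₂ (S , bS , i∉S , refl) | inj₁ (gB′ , ¬bB) =
      subst (t ≤_) (cong ∣_∣ (∩-comm B (S - e))) (kept-trimmed gB′ ¬bB bS i∉S)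
    ... | inj₂ (S , bS , i∉S , refl) | inj₂ (T , bT , i∉T , refl) = trimmed-trimmed bS i∉S bT i∉T

    Fᵢ-intersecting : TIntersecting t (Fᵢ F e a i)
    Fᵢ-intersecting B C FᵢB FᵢC with Fᵢ⁻ i FᵢB | Fᵢ⁻ i FᵢC
    ... | A , gA , A⊆B | A′ , gA′ , A′⊆C =
      ℕ.≤-trans (Gᵢ-intersecting gA gA′)
                (p⊆q⇒∣p∣≤∣q∣ (λ x∈ → x∈p∩q⁺ (Product.map A⊆B A′⊆C (x∈p∩q⁻ A A′ x∈))))

module Exchange {n : ℕ} (a : ℕ) (F : Family n) (e : Fin n)
  (mono : Monotone F) (lc : LeftCompressed F)
  (bounded : ∀ S x → isGen F S ≡ true → x ∈ S → toℕ x ≤ toℕ e) where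
  open Generators F
  open Modification F e a

  boundary≡truncateAt : ∀ {S} → IsBoundaryₐ S → truncateAt e (⁅< e ⁆ ∩ S) ≡ S
  boundary≡truncateAt {S} (gS , e∈S , _) = ⊆-antisym ⊆S (⊆-truncateAt (bounded S _ gS) below)
    where
    below : ∀ {x} → x ∈ S → toℕ x < toℕ e → x ∈ ⁅< e ⁆ ∩ S
    below x∈S x<e = x∈p∩q⁺ (∈⁅<⁆⁺ x<e , x∈S)
    ⊆S : truncateAt e (⁅< e ⁆ ∩ S) ⊆ S
    ⊆S x∈ with ∈-truncateAt⁻ x∈
    ... | inj₁ refl       = e∈S
    ... | inj₂ (_ , x∈′)  = proj₂ (x∈p∩q⁻ ⁅< e ⁆ S x∈′)

  module _ (i : Fin n) where

    -- A member C of F outside Fᵢ lies above a boundary generating set T, and left compression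
    -- forces T to contain every point of C below e.
    Fᵢ-false⇒boundary : ∀ {C} → F C ≡ true → Fᵢ F e a i C ≡ false → IsBoundaryₐ (truncateAt e C)
    Fᵢ-false⇒boundary {C} FC ¬FᵢC with ∃isGen-⊆ FC
    ... | T , T⊆C , gT = subst IsBoundaryₐ (⊆-antisym T⊆ ⊆T) bT
      where
      bT : IsBoundaryₐ T
      bT with GStarₐ F e a T in b
      ... | true  = GStarₐ⁻ b
      ... | false =
        ⊥-elim (true≢false (Fᵢ⁺ i (Gᵢ-kept i gT (λ bT → true≢false (GStarₐ⁺ bT) b)) T⊆C) ¬FᵢC)
      T⊆ : T ⊆ truncateAt e C
      T⊆ = ⊆-truncateAt (bounded T _ gT) (λ x∈T _ → T⊆C x∈T)
      ⊆T : truncateAt e C ⊆ T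
      ⊆T x∈ with ∈-truncateAt⁻ x∈
      ... | inj₁ refl = proj₁ (proj₂ bT)
      ... | inj₂ (x<e , x∈C) with _ ∈? T
      ...   | yes x∈T = x∈T
      ...   | no  x∉T with ∃isGen-⊆ (lc T e _ (isGen⇒∈ gT) (proj₁ (proj₂ bT)) x∉T x<e)
      ...     | R , R⊆ , gR = ⊥-elim (true≢false (Fᵢ⁺ i (Gᵢ-kept i gR ¬bR) R⊆C) ¬FᵢC)
        where
        R⊆C : R ⊆ C
        R⊆C y∈R with x∈p∪q⁻ (T - e) _ (R⊆ y∈R)
        ... | inj₁ y∈T-e = T⊆C (proj₁ (x∈p-y⁻ y∈T-e))
        ... | inj₂ y∈⁅x⁆ rewrite x∈⁅y⁆⇒x≡y _ y∈⁅x⁆ = x∈C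
        ¬bR : ¬ IsBoundaryₐ R
        ¬bR (_ , e∈R , _) with x∈p∪q⁻ (T - e) _ (R⊆ e∈R)
        ... | inj₁ e∈T-e = x∉p-x T e∈T-e
        ... | inj₂ e∈⁅x⁆ rewrite x∈⁅y⁆⇒x≡y _ e∈⁅x⁆ = ℕ.<-irrefl refl x<e

  module AtBoundary {A : Subset n} (e∉A : e ∉ A) (bS : IsBoundaryₐ (truncateAt e A)) where

    private
      S : Subset n
      S = truncateAt e A
      gS : isGen F S ≡ true
      gS = proj₁ bS

      below-e : ∀ {x} → x ∈ A [ e ]≔ true → toℕ x < toℕ e → x ∈ A
      below-e x∈ x<e with ∈-[]≔true⁻ A e x∈
      ... | inj₁ x∈A  = x∈A
      ... | inj₂ refl = contradiction x<e (ℕ.<-irrefl refl)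

      generator-⊆S : ∀ {R} → isGen F R ≡ true → R ⊆ A [ e ]≔ true → R ⊆ S
      generator-⊆S gR R⊆ = ⊆-truncateAt (bounded _ _ gR) (λ x∈R → below-e (R⊆ x∈R))

    F-A≡false : F A ≡ false
    F-A≡false with F A in FA
    ... | false = refl
    ... | true with ∃isGen-⊆ FA
    ...   | T , T⊆A , gT = ⊥-elim (true≢false (isGen⇒∈ gT) (isGen⇒minimal gS T⊆S T≢S))
      where
      T⊆S : T ⊆ S
      T⊆S = generator-⊆S gT (⊆-trans T⊆A (p⊆p[x]≔true A e))
      T≢S : T ≢ S
      T≢S T≡S = e∉A (T⊆A (subst (e ∈_) (sym T≡S) e∈truncateAt))

    F-A[e]≡true : F (A [ e ]≔ true) ≡ true
    F-A[e]≡true = mono S (A [ e ]≔ true) S⊆ (isGen⇒∈ gS)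
      where
      S⊆ : S ⊆ A [ e ]≔ true
      S⊆ x∈S with ∈-truncateAt⁻ x∈S
      ... | inj₁ refl          = x∈p[x]≔true A e
      ... | inj₂ (_ , x∈A)     = p⊆p[x]≔true A e x∈A

    module _ (i : Fin n) (i<e : toℕ i < toℕ e) where

      Fᵢ-A≡true : i ∉ A → Fᵢ F e a i A ≡ true
      Fᵢ-A≡true i∉A = Fᵢ⁺ i (Gᵢ-trimmed i bS i∉S) S-e⊆A
        where
        i∉S : i ∉ S
        i∉S i∈S with ∈-truncateAt⁻ i∈S
        ... | inj₁ refl      = ℕ.<-irrefl refl i<e
        ... | inj₂ (_ , i∈A) = i∉A i∈A
        S-e⊆A : S - e ⊆ A
        S-e⊆A x∈ with x∈p-y⁻ x∈
        ... | x∈S , x≢e with ∈-truncateAt⁻ x∈S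
        ...   | inj₁ x≡e       = contradiction x≡e x≢e
        ...   | inj₂ (_ , x∈A) = x∈A

      Fᵢ-A[e]≡false : i ∈ A → Fᵢ F e a i (A [ e ]≔ true) ≡ false
      Fᵢ-A[e]≡false i∈A with Fᵢ F e a i (A [ e ]≔ true) in FᵢA[e]
      ... | false = refl
      ... | true with Fᵢ⁻ i FᵢA[e]
      ...   | R , gR , R⊆ with Gᵢ⁻ i gR
      ...     | inj₁ (gR′ , ¬bR) =
        contradiction (subst IsBoundaryₐ (sym (isGen-⊆⇒≡ gS gR′ (generator-⊆S gR′ R⊆))) bS) ¬bR
      ...     | inj₂ (T , bT , i∉T , refl) =
        contradiction (subst (i ∈_) (sym (isGen-⊆⇒≡ gS (proj₁ bT) T⊆S)) (∈-truncateAt⁺ i<e i∈A)) i∉T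
        where
        T⊆S : T ⊆ S
        T⊆S = ⊆-truncateAt (bounded _ _ (proj₁ bT))
                (λ x∈T x<e → below-e (R⊆ (x∈p∧x≢y⇒x∈p-y x∈T λ { refl → ℕ.<-irrefl refl x<e })) x<e)

      Fᵢ-between : ∀ {B} → A ⊆ B → B ⊆ A [ e ]≔ true → Fᵢ F e a i B ≡ lookup (∁ A) i
      Fᵢ-between {B} A⊆B B⊆ rewrite lookup-map i not A with lookup A i in Ai
      ... | false = Fᵢ-monotone i A⊆B (Fᵢ-A≡true λ i∈A → true≢false ([]=⇒lookup i∈A) Ai)
      ... | true with Fᵢ F e a i B in FᵢB
      ...   | false = refl
      ...   | true  = ⊥-elim (true≢false (Fᵢ-monotone i B⊆ FᵢB) (Fᵢ-A[e]≡false (lookup⇒[]= i A Ai)))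

ℕ→ℚ-+ : ∀ m k → ℕ→ℚ (m + k) ≡ ℕ→ℚ m ℚ.+ ℕ→ℚ k
ℕ→ℚ-+ m k = ℚ.toℚᵘ-injective (ℚᵘ.≃-trans (ℚ.toℚᵘ-fromℚᵘ (ℕ→ℚᵘ (m + k)))
  (ℚᵘ.≃-trans (ℚᵘ.*≡* additive)
  (ℚᵘ.≃-trans (ℚᵘ.+-cong (ℚᵘ.≃-sym (ℚ.toℚᵘ-fromℚᵘ (ℕ→ℚᵘ m))) (ℚᵘ.≃-sym (ℚ.toℚᵘ-fromℚᵘ (ℕ→ℚᵘ k))))
              (ℚᵘ.≃-sym (ℚ.toℚᵘ-homo-+ (ℕ→ℚ m) (ℕ→ℚ k))))))
  where
  ℕ→ℚᵘ : ℕ → ℚᵘ.ℚᵘ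
  ℕ→ℚᵘ k = ℚᵘ.mkℚᵘ (ℤ.+ k) 0
  additive : ℤ.+ (m + k) ℤ.* ℤ.+ 1 ≡ (ℤ.+ m ℤ.* ℤ.+ 1 ℤ.+ ℤ.+ k ℤ.* ℤ.+ 1) ℤ.* ℤ.+ 1
  additive rewrite ℤ.*-identityʳ (ℤ.+ m) | ℤ.*-identityʳ (ℤ.+ k)
                 | ℤ.*-identityʳ (ℤ.+ m ℤ.+ ℤ.+ k) = refl

ℕ→ℚ-nonNeg : ∀ k → 0ℚ ℚ.≤ ℕ→ℚ k
ℕ→ℚ-nonNeg k = ℚ.nonNegative⁻¹ (ℕ→ℚ k) {{ℚ.normalize-nonNeg k 1}}

module _ {X : Set} where

  ∑ : List X → (X → ℚ) → ℚ
  ∑ xs f = foldr ℚ._+_ 0ℚ (map f xs)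

  ∑-++ : ∀ xs ys (f : X → ℚ) → ∑ (xs ++ ys) f ≡ ∑ xs f ℚ.+ ∑ ys f
  ∑-++ List.[]       ys f = sym (ℚ.+-identityˡ _)
  ∑-++ (x List.∷ xs) ys f = trans (cong (f x ℚ.+_) (∑-++ xs ys f)) (sym (ℚ.+-assoc (f x) _ _))

  ∑-+ : ∀ xs (f g : X → ℚ) → ∑ xs (λ x → f x ℚ.+ g x) ≡ ∑ xs f ℚ.+ ∑ xs g
  ∑-+ List.[]       f g = refl
  ∑-+ (x List.∷ xs) f g = trans (cong (f x ℚ.+ g x ℚ.+_) (∑-+ xs f g))
    (solve 4 (λ a b c d → (a :+ b) :+ (c :+ d) := (a :+ c) :+ (b :+ d)) refl
             (f x) (g x) (∑ xs f) (∑ xs g))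

  ∑-zero : ∀ xs → ∑ xs (λ _ → 0ℚ) ≡ 0ℚ
  ∑-zero List.[]       = refl
  ∑-zero (x List.∷ xs) = trans (ℚ.+-identityˡ _) (∑-zero xs)

  ∑-mono-≤ : ∀ xs {f g : X → ℚ} → (∀ x → f x ℚ.≤ g x) → ∑ xs f ℚ.≤ ∑ xs g
  ∑-mono-≤ List.[]       f≤g = ℚ.≤-refl
  ∑-mono-≤ (x List.∷ xs) f≤g = ℚ.+-mono-≤ (f≤g x) (∑-mono-≤ xs f≤g)

  ∑-mono-< : ∀ {xs y} {f g : X → ℚ} → (∀ x → f x ℚ.≤ g x) → y ∈ₗ xs → f y ℚ.< g y →
             ∑ xs f ℚ.< ∑ xs g
  ∑-mono-< {_ List.∷ xs} f≤g (Any.here refl) fy<gy = ℚ.+-mono-<-≤ fy<gy (∑-mono-≤ xs f≤g)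
  ∑-mono-< {x List.∷ _}  f≤g (Any.there y∈) fy<gy = ℚ.+-mono-≤-< (f≤g x) (∑-mono-< f≤g y∈ fy<gy)

∑-map : ∀ {X Y : Set} xs (h : X → Y) (f : Y → ℚ) → ∑ (map h xs) f ≡ ∑ xs (f ∘ h)
∑-map xs h f = cong (foldr ℚ._+_ 0ℚ) (sym (map-∘ xs))

∑-allSubsets-suc : (g : Subset (suc n) → ℚ) →
  ∑ (allSubsets (suc n)) g ≡ ∑ (allSubsets n) (g ∘ (true ∷_)) ℚ.+ ∑ (allSubsets n) (g ∘ (false ∷_))
∑-allSubsets-suc {n} g = trans (∑-++ (map (true ∷_) (allSubsets n)) _ g)
  (cong₂ ℚ._+_ (∑-map (allSubsets n) (true ∷_) g) (∑-map (allSubsets n) (false ∷_) g))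

-- Each A with e ∉ A stands for the pair {A, A ∪ {e}}.
∑-pairs : ∀ (e : Fin n) (g : Subset n → ℚ) →
  ∑ (allSubsets n) g ≡ ∑ (allSubsets n) (λ A → if lookup A e then 0ℚ else g A ℚ.+ g (A [ e ]≔ true))
∑-pairs {suc n} fzero g = begin
  ∑ (allSubsets (suc n)) g                                  ≡⟨ ∑-allSubsets-suc g ⟩
  ∑ subsets (g ∘ (true ∷_)) ℚ.+ ∑ subsets (g ∘ (false ∷_))  ≡⟨ ℚ.+-comm (∑ subsets _) _ ⟩
  ∑ subsets (g ∘ (false ∷_)) ℚ.+ ∑ subsets (g ∘ (true ∷_))  ≡⟨ ∑-+ subsets _ _ ⟨
  ∑ subsets pair                                            ≡⟨ ℚ.+-identityˡ (∑ subsets pair) ⟨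
  0ℚ ℚ.+ ∑ subsets pair
    ≡⟨ cong (ℚ._+ ∑ subsets pair) (∑-zero subsets) ⟨
  ∑ subsets (λ _ → 0ℚ) ℚ.+ ∑ subsets pair
    ≡⟨ ∑-allSubsets-suc (λ A → if lookup A fzero then 0ℚ else g A ℚ.+ g (A [ fzero ]≔ true)) ⟨
  ∑ (allSubsets (suc n)) (λ A → if lookup A fzero then 0ℚ else g A ℚ.+ g (A [ fzero ]≔ true)) ∎
  where
  open ≡-Reasoning
  subsets : List (Subset n)
  subsets = allSubsets n
  pair : Subset n → ℚ
  pair A = g (false ∷ A) ℚ.+ g (true ∷ A)
∑-pairs {suc n} (fsuc e) g = begin
  ∑ (allSubsets (suc n)) g
    ≡⟨ ∑-allSubsets-suc g ⟩
  ∑ (allSubsets n) (g ∘ (true ∷_)) ℚ.+ ∑ (allSubsets n) (g ∘ (false ∷_))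
    ≡⟨ cong₂ ℚ._+_ (∑-pairs e (g ∘ (true ∷_))) (∑-pairs e (g ∘ (false ∷_))) ⟩
  _ ≡⟨ ∑-allSubsets-suc (λ A → if lookup A (fsuc e) then 0ℚ else g A ℚ.+ g (A [ fsuc e ]≔ true)) ⟨
  ∑ (allSubsets (suc n)) (λ A → if lookup A (fsuc e) then 0ℚ else g A ℚ.+ g (A [ fsuc e ]≔ true)) ∎
  where open ≡-Reasoning

∑∈ : Subset n → (Fin n → ℚ) → ℚ
∑∈ []          f = 0ℚ
∑∈ (true  ∷ I) f = f fzero ℚ.+ ∑∈ I (f ∘ fsuc)
∑∈ (false ∷ I) f = ∑∈ I (f ∘ fsuc)

∑∈-cong : ∀ (I : Subset n) {f g} → (∀ {i} → i ∈ I → f i ≡ g i) → ∑∈ I f ≡ ∑∈ I g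
∑∈-cong []          f≡g = refl
∑∈-cong (true  ∷ I) f≡g = cong₂ ℚ._+_ (f≡g here) (∑∈-cong I (f≡g ∘ there))
∑∈-cong (false ∷ I) f≡g = ∑∈-cong I (f≡g ∘ there)

∑∈-mono-≤ : ∀ (I : Subset n) {f g} → (∀ {i} → i ∈ I → f i ℚ.≤ g i) → ∑∈ I f ℚ.≤ ∑∈ I g
∑∈-mono-≤ []          f≤g = ℚ.≤-refl
∑∈-mono-≤ (true  ∷ I) f≤g = ℚ.+-mono-≤ (f≤g here) (∑∈-mono-≤ I (f≤g ∘ there))
∑∈-mono-≤ (false ∷ I) f≤g = ∑∈-mono-≤ I (f≤g ∘ there)

∑∈-<⇒∃ : ∀ (I : Subset n) {f g} → ∑∈ I f ℚ.< ∑∈ I g → ∃ λ i → i ∈ I × f i ℚ.< g i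
∑∈-<⇒∃ []          lt = contradiction lt (ℚ.<-irrefl refl)
∑∈-<⇒∃ (false ∷ I) lt = Product.map fsuc (Product.map₁ there) (∑∈-<⇒∃ I lt)
∑∈-<⇒∃ (true  ∷ I) {f} {g} lt with f fzero ℚ.<? g fzero
... | yes lt₀ = fzero , here , lt₀
... | no  ¬lt₀ with ∑∈ I (f ∘ fsuc) ℚ.<? ∑∈ I (g ∘ fsuc)
...   | yes ltₛ = Product.map fsuc (Product.map₁ there) (∑∈-<⇒∃ I ltₛ)
...   | no  ¬ltₛ = ⊥-elim (ℚ.<-irrefl refl (ℚ.<-≤-trans lt (ℚ.+-mono-≤ (ℚ.≮⇒≥ ¬lt₀) (ℚ.≮⇒≥ ¬ltₛ))))

∑∈-indicator : ∀ (I J : Subset n) c →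
  ∑∈ I (λ i → if lookup J i then c else 0ℚ) ≡ ℕ→ℚ ∣ I ∩ J ∣ ℚ.* c
∑∈-indicator []          []          c = sym (ℚ.*-zeroˡ c)
∑∈-indicator (true  ∷ I) (true  ∷ J) c = begin
  c ℚ.+ ∑∈ I (λ i → if lookup J i then c else 0ℚ)
                                      ≡⟨ cong (c ℚ.+_) (∑∈-indicator I J c) ⟩
  c ℚ.+ ℕ→ℚ ∣ I ∩ J ∣ ℚ.* c            ≡⟨ cong (ℚ._+ ℕ→ℚ ∣ I ∩ J ∣ ℚ.* c) (ℚ.*-identityˡ c) ⟨
  1ℚ ℚ.* c ℚ.+ ℕ→ℚ ∣ I ∩ J ∣ ℚ.* c     ≡⟨ ℚ.*-distribʳ-+ c 1ℚ (ℕ→ℚ ∣ I ∩ J ∣) ⟨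
  (1ℚ ℚ.+ ℕ→ℚ ∣ I ∩ J ∣) ℚ.* c         ≡⟨ cong (ℚ._* c) (ℕ→ℚ-+ 1 ∣ I ∩ J ∣) ⟨
  ℕ→ℚ (suc ∣ I ∩ J ∣) ℚ.* c            ∎
  where open ≡-Reasoning
∑∈-indicator (true  ∷ I) (false ∷ J) c = trans (ℚ.+-identityˡ _) (∑∈-indicator I J c)
∑∈-indicator (false ∷ I) (_     ∷ J) c = ∑∈-indicator I J c

∑∈-const : ∀ (I : Subset n) c → ∑∈ I (λ _ → c) ≡ ℕ→ℚ ∣ I ∣ ℚ.* c
∑∈-const {n} I c = begin
  ∑∈ I (λ _ → c)
    ≡⟨ ∑∈-cong I (λ {i} _ → cong (if_then c else 0ℚ) (lookup-replicate i true)) ⟨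
  ∑∈ I (λ i → if lookup ⊤ i then c else 0ℚ)   ≡⟨ ∑∈-indicator I ⊤ c ⟩
  ℕ→ℚ ∣ I ∩ ⊤ ∣ ℚ.* c                           ≡⟨ cong (λ J → ℕ→ℚ ∣ J ∣ ℚ.* c) (∩-identityʳ I) ⟩
  ℕ→ℚ ∣ I ∣ ℚ.* c                               ∎
  where open ≡-Reasoning

∑∈-∑ : ∀ {X : Set} (I : Subset n) xs (h : Fin n → X → ℚ) →
       ∑∈ I (λ i → ∑ xs (h i)) ≡ ∑ xs (λ x → ∑∈ I (λ i → h i x))
∑∈-∑ []          xs h = sym (∑-zero xs)
∑∈-∑ (true  ∷ I) xs h = trans (cong (∑ xs (h fzero) ℚ.+_) (∑∈-∑ I xs (h ∘ fsuc))) (sym (∑-+ xs _ _))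
∑∈-∑ (false ∷ I) xs h = ∑∈-∑ I xs (h ∘ fsuc)

∸-suc : ∀ {k m} → suc k ≤ m → m ∸ k ≡ suc (m ∸ suc k)
∸-suc {zero}  {suc m} _          = refl
∸-suc {suc k} {suc m} (s≤s k<m) = ∸-suc k<m

*-pos : ∀ {x y} → 0ℚ ℚ.< x → 0ℚ ℚ.< y → 0ℚ ℚ.< x ℚ.* y
*-pos {x} {y} 0<x 0<y =
  ℚ.positive⁻¹ (x ℚ.* y) {{ℚ.pos*pos⇒pos x {{ℚ.positive 0<x}} y {{ℚ.positive 0<y}}}}

^ℚ-pos : ∀ {x} k → 0ℚ ℚ.< x → 0ℚ ℚ.< x ^ℚ k
^ℚ-pos zero    0<x = ℚ.positive⁻¹ 1ℚ
^ℚ-pos (suc k) 0<x = *-pos 0<x (^ℚ-pos k 0<x)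

module Weights {n : ℕ} (p : ℚ) (0<p : 0ℚ ℚ.< p) (p<1 : p ℚ.< 1ℚ) where

  weight : Subset n → ℚ
  weight A = (p ^ℚ ∣ A ∣) ℚ.* ((1ℚ ℚ.- p) ^ℚ (n ∸ ∣ A ∣))

  0<1-p : 0ℚ ℚ.< 1ℚ ℚ.- p
  0<1-p = ℚ.≤-<-trans (ℚ.≤-reflexive (sym (ℚ.+-inverseʳ p))) (ℚ.+-monoˡ-< (ℚ.- p) p<1)

  0<weight : ∀ A → 0ℚ ℚ.< weight A
  0<weight A = *-pos (^ℚ-pos ∣ A ∣ 0<p) (^ℚ-pos (n ∸ ∣ A ∣) 0<1-p)

  module _ {A : Subset n} {e : Fin n} (e∉A : e ∉ A) where

    common : ℚ
    common = (p ^ℚ ∣ A ∣) ℚ.* ((1ℚ ℚ.- p) ^ℚ (n ∸ suc ∣ A ∣))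

    0<common : 0ℚ ℚ.< common
    0<common = *-pos (^ℚ-pos ∣ A ∣ 0<p) (^ℚ-pos (n ∸ suc ∣ A ∣) 0<1-p)

    private
      ∣A[e]∣≡1+∣A∣ : ∣ A [ e ]≔ true ∣ ≡ suc ∣ A ∣
      ∣A[e]∣≡1+∣A∣ = x∉p⇒∣p[x]≔true∣≡1+∣p∣ A e∉A

    weight-without : weight A ≡ (1ℚ ℚ.- p) ℚ.* common
    weight-without = begin
      (p ^ℚ ∣ A ∣) ℚ.* ((1ℚ ℚ.- p) ^ℚ (n ∸ ∣ A ∣))
        ≡⟨ cong (λ k → (p ^ℚ ∣ A ∣) ℚ.* ((1ℚ ℚ.- p) ^ℚ k)) n∸∣A∣ ⟩
      (p ^ℚ ∣ A ∣) ℚ.* ((1ℚ ℚ.- p) ℚ.* ((1ℚ ℚ.- p) ^ℚ (n ∸ suc ∣ A ∣)))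
        ≡⟨ solve 3 (λ x y z → x :* (y :* z) := y :* (x :* z)) refl
                   (p ^ℚ ∣ A ∣) (1ℚ ℚ.- p) ((1ℚ ℚ.- p) ^ℚ (n ∸ suc ∣ A ∣)) ⟩
      (1ℚ ℚ.- p) ℚ.* common ∎
      where
      open ≡-Reasoning
      n∸∣A∣ : n ∸ ∣ A ∣ ≡ suc (n ∸ suc ∣ A ∣)
      n∸∣A∣ = ∸-suc (subst (_≤ n) ∣A[e]∣≡1+∣A∣ (∣p∣≤n (A [ e ]≔ true)))

    weight-with : weight (A [ e ]≔ true) ≡ p ℚ.* common
    weight-with = begin
      (p ^ℚ ∣ A [ e ]≔ true ∣) ℚ.* ((1ℚ ℚ.- p) ^ℚ (n ∸ ∣ A [ e ]≔ true ∣))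
        ≡⟨ cong (λ k → (p ^ℚ k) ℚ.* ((1ℚ ℚ.- p) ^ℚ (n ∸ k))) ∣A[e]∣≡1+∣A∣ ⟩
      (p ℚ.* (p ^ℚ ∣ A ∣)) ℚ.* ((1ℚ ℚ.- p) ^ℚ (n ∸ suc ∣ A ∣))
        ≡⟨ ℚ.*-assoc p _ _ ⟩
      p ℚ.* common ∎
      where open ≡-Reasoning

k+k+t≡1+e : ∀ {c k e a t} → c + k ≡ e → suc c ≡ a → suc e + t ≡ 2 * a → k + k + t ≡ suc e
k+k+t≡1+e {c} {k} {t = t} refl refl m+t≡2a = begin
  k + k + t        ≡⟨ ℕ.+-assoc k k t ⟩
  k + (k + t)      ≡⟨ cong (k +_) k+t≡1+c ⟩
  k + suc c        ≡⟨ ℕ.+-suc k c ⟩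
  suc (k + c)      ≡⟨ cong suc (ℕ.+-comm k c) ⟩
  suc (c + k)      ∎
  where
  open ≡-Reasoning
  k+t≡1+c : k + t ≡ suc c
  k+t≡1+c = ℕ.+-cancelˡ-≡ (suc c) _ _ (begin
    suc c + (k + t)         ≡⟨ cong suc (ℕ.+-assoc c k t) ⟨
    suc (c + k) + t         ≡⟨ m+t≡2a ⟩
    2 * suc c               ≡⟨ cong (suc c +_) (ℕ.+-identityʳ (suc c)) ⟩
    suc c + suc c           ∎)

halve-< : ∀ {x y} → x ℚ.+ x ℚ.< y ℚ.+ y → x ℚ.< y
halve-< {x} {y} 2x<2y with x ℚ.<? y
... | yes x<y = x<y
... | no  x≮y = ⊥-elim (ℚ.<-irrefl refl (ℚ.<-≤-trans 2x<2y (ℚ.+-mono-≤ (ℚ.≮⇒≥ x≮y) (ℚ.≮⇒≥ x≮y))))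

ℕ→ℚ-mono-≤ : ∀ {j k} → j ≤ k → ℕ→ℚ j ℚ.≤ ℕ→ℚ k
ℕ→ℚ-mono-≤ {j} j≤k with ℕ.m≤n⇒∃[o]m+o≡n j≤k
... | d , refl = begin
  ℕ→ℚ j            ≡⟨ ℚ.+-identityʳ (ℕ→ℚ j) ⟨
  ℕ→ℚ j ℚ.+ 0ℚ     ≤⟨ ℚ.+-monoʳ-≤ (ℕ→ℚ j) (ℕ→ℚ-nonNeg d) ⟩
  ℕ→ℚ j ℚ.+ ℕ→ℚ d  ≡⟨ ℕ→ℚ-+ j d ⟨
  ℕ→ℚ (j + d)      ∎
  where open ℚ.≤-Reasoning

module Margin {n : ℕ} (t a : ℕ) (e : Fin n) (m+t≡2a : suc (toℕ e) + t ≡ 2 * a)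
  (p : ℚ) (p-small : p ℚ.* ℕ→ℚ (2 * toℕ e) ℚ.< ℕ→ℚ (suc (toℕ e)) ℚ.- ℕ→ℚ t) where

  free : Subset n → ℕ
  free A = ∣ ⁅< e ⁆ ∩ ∁ A ∣

  module _ {A : Subset n} (∣S∣≡a : ∣ truncateAt e A ∣ ≡ a) where

    private
      used+free≡e : ∣ ⁅< e ⁆ ∩ A ∣ + free A ≡ toℕ e
      used+free≡e = trans (∣p∩q∣+∣p∩∁q∣≡∣p∣ ⁅< e ⁆ A) (∣⁅<e⁆∣≡e e)

    free≤e : free A ≤ toℕ e
    free≤e = subst (free A ≤_) (trans (ℕ.+-comm (free A) _) used+free≡e) (ℕ.m≤m+n (free A) _)

    free+free+t≡m : free A + free A + t ≡ suc (toℕ e)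
    free+free+t≡m = k+k+t≡1+e used+free≡e
                               (trans (sym (∣truncateAt∣ {e = e} {C = A})) ∣S∣≡a) m+t≡2a

    margin : p ℚ.* ℕ→ℚ (toℕ e) ℚ.< ℕ→ℚ (free A)
    margin = halve-< (subst₂ ℚ._<_ lhs rhs p-small)
      where
      E K T : ℚ
      E = ℕ→ℚ (toℕ e)
      K = ℕ→ℚ (free A)
      T = ℕ→ℚ t
      lhs : p ℚ.* ℕ→ℚ (2 * toℕ e) ≡ p ℚ.* E ℚ.+ p ℚ.* E
      lhs = trans (cong (p ℚ.*_) (trans (cong (λ k → ℕ→ℚ (toℕ e + k)) (ℕ.+-identityʳ (toℕ e)))
                                        (ℕ→ℚ-+ (toℕ e) (toℕ e))))
                  (ℚ.*-distribˡ-+ p E E)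
      rhs : ℕ→ℚ (suc (toℕ e)) ℚ.- T ≡ K ℚ.+ K
      rhs = begin
        ℕ→ℚ (suc (toℕ e)) ℚ.- T              ≡⟨ cong (λ k → ℕ→ℚ k ℚ.- T) free+free+t≡m ⟨
        ℕ→ℚ (free A + free A + t) ℚ.- T       ≡⟨ cong (ℚ._- T) (ℕ→ℚ-+ (free A + free A) t) ⟩
        (ℕ→ℚ (free A + free A) ℚ.+ T) ℚ.- T   ≡⟨ cong (λ x → x ℚ.+ T ℚ.- T) (ℕ→ℚ-+ (free A) (free A)) ⟩
        (K ℚ.+ K ℚ.+ T) ℚ.- T                 ≡⟨ solve 2 (λ k t → (k :+ k :+ t) :- t := k :+ k) refl K T ⟩
        K ℚ.+ K                               ∎
        where open ≡-Reasoning

    p<1 : p ℚ.< 1ℚ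
    p<1 with p ℚ.<? 1ℚ
    ... | yes p<1 = p<1
    ... | no  p≮1 = ⊥-elim (ℚ.<-irrefl refl (ℚ.<-≤-trans margin (begin
      K                 ≤⟨ ℕ→ℚ-mono-≤ free≤e ⟩
      E                 ≡⟨ ℚ.*-identityˡ E ⟨
      1ℚ ℚ.* E          ≤⟨ ℚ.*-monoʳ-≤-nonNeg E {{ℚ.nonNegative (ℕ→ℚ-nonNeg (toℕ e))}} (ℚ.≮⇒≥ p≮1) ⟩
      p ℚ.* E           ∎)))
      where
      open ℚ.≤-Reasoning
      E K : ℚ
      E = ℕ→ℚ (toℕ e)
      K = ℕ→ℚ (free A)

module Averaging {n : ℕ} (t a : ℕ) (F : Family n) (e : Fin n)
  (mono : Monotone F) (lc : LeftCompressed F)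
  (bounded : ∀ S x → isGen F S ≡ true → x ∈ S → toℕ x ≤ toℕ e)
  (m+t≡2a : suc (toℕ e) + t ≡ 2 * a)
  (p : ℚ) (0<p : 0ℚ ℚ.< p) (p<1 : p ℚ.< 1ℚ)
  (p-small : p ℚ.* ℕ→ℚ (2 * toℕ e) ℚ.< ℕ→ℚ (suc (toℕ e)) ℚ.- ℕ→ℚ t) where
  open Generators F
  open Modification F e a
  open Exchange a F e mono lc bounded
  open Margin t a e m+t≡2a p p-small using (free; margin)
  open Weights {n} p 0<p p<1

  original modified : Fin n → Family n
  original _ = F
  modified i = Fᵢ F e a i

  Φ : (Fin n → Family n) → Subset n → ℚ
  Φ G B = ∑∈ ⁅< e ⁆ (λ i → if G i B then weight B else 0ℚ)

  ∑∈-μ : ∀ G → ∑∈ ⁅< e ⁆ (λ i → μ p (G i)) ≡ ∑ (allSubsets n) (Φ G)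
  ∑∈-μ G = ∑∈-∑ ⁅< e ⁆ (allSubsets n) (λ i B → if G i B then weight B else 0ℚ)

  off-boundary : ∀ {B} → ¬ IsBoundaryₐ (truncateAt e B) → Φ original B ℚ.≤ Φ modified B
  off-boundary {B} ¬bB = ∑∈-mono-≤ ⁅< e ⁆ (λ {i} _ → pointwise i)
    where
    pointwise : ∀ i → (if F B then weight B else 0ℚ) ℚ.≤ (if Fᵢ F e a i B then weight B else 0ℚ)
    pointwise i with F B in FB | Fᵢ F e a i B in FᵢB
    ... | true  | true  = ℚ.≤-refl
    ... | true  | false = contradiction (Fᵢ-false⇒boundary i FB FᵢB) ¬bB
    ... | false | true  = ℚ.<⇒≤ (0<weight B)
    ... | false | false = ℚ.≤-refl

  module _ {A : Subset n} (e∉A : e ∉ A) (bS : IsBoundaryₐ (truncateAt e A)) where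
    open AtBoundary e∉A bS
    open ≡-Reasoning

    private
      A⁺ : Subset n
      A⁺ = A [ e ]≔ true
      Q E K : ℚ
      Q = common e∉A
      E = ℕ→ℚ (toℕ e)
      K = ℕ→ℚ (free A)

    Φ-modified : ∀ {B} → A ⊆ B → B ⊆ A⁺ → Φ modified B ≡ K ℚ.* weight B
    Φ-modified {B} A⊆B B⊆ = trans
      (∑∈-cong ⁅< e ⁆ (λ {i} i∈ → cong (if_then weight B else 0ℚ) (Fᵢ-between i (∈⁅<⁆⁻ i∈) A⊆B B⊆)))
      (∑∈-indicator ⁅< e ⁆ (∁ A) (weight B))

    Φ-original-pair : Φ original A ℚ.+ Φ original A⁺ ≡ (p ℚ.* E) ℚ.* Q
    Φ-original-pair = begin
      Φ original A ℚ.+ Φ original A⁺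
        ≡⟨ cong₂ ℚ._+_ (∑∈-cong ⁅< e ⁆ (λ _ → cong (if_then weight A else 0ℚ) F-A≡false))
                       (∑∈-cong ⁅< e ⁆ (λ _ → cong (if_then weight A⁺ else 0ℚ) F-A[e]≡true)) ⟩
      ∑∈ ⁅< e ⁆ (λ _ → 0ℚ) ℚ.+ ∑∈ ⁅< e ⁆ (λ _ → weight A⁺)
        ≡⟨ cong₂ ℚ._+_ (∑∈-const ⁅< e ⁆ 0ℚ) (∑∈-const ⁅< e ⁆ (weight A⁺)) ⟩
      ℕ→ℚ ∣ ⁅< e ⁆ ∣ ℚ.* 0ℚ ℚ.+ ℕ→ℚ ∣ ⁅< e ⁆ ∣ ℚ.* weight A⁺
        ≡⟨ cong (λ k → ℕ→ℚ k ℚ.* 0ℚ ℚ.+ ℕ→ℚ k ℚ.* weight A⁺) (∣⁅<e⁆∣≡e e) ⟩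
      E ℚ.* 0ℚ ℚ.+ E ℚ.* weight A⁺
        ≡⟨ cong (λ w → E ℚ.* 0ℚ ℚ.+ E ℚ.* w) (weight-with e∉A) ⟩
      E ℚ.* 0ℚ ℚ.+ E ℚ.* (p ℚ.* Q)
        ≡⟨ solve 3 (λ E p Q → E :* con 0ℚ :+ E :* (p :* Q) := (p :* E) :* Q) refl E p Q ⟩
      (p ℚ.* E) ℚ.* Q ∎

    Φ-modified-pair : Φ modified A ℚ.+ Φ modified A⁺ ≡ K ℚ.* Q
    Φ-modified-pair = begin
      Φ modified A ℚ.+ Φ modified A⁺
        ≡⟨ cong₂ ℚ._+_ (Φ-modified ⊆-refl (p⊆p[x]≔true A e)) (Φ-modified (p⊆p[x]≔true A e) ⊆-refl) ⟩
      K ℚ.* weight A ℚ.+ K ℚ.* weight A⁺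
        ≡⟨ cong₂ (λ w w′ → K ℚ.* w ℚ.+ K ℚ.* w′) (weight-without e∉A) (weight-with e∉A) ⟩
      K ℚ.* ((1ℚ ℚ.- p) ℚ.* Q) ℚ.+ K ℚ.* (p ℚ.* Q)
        ≡⟨ solve 3 (λ K p Q → K :* ((con 1ℚ :- p) :* Q) :+ K :* (p :* Q) := K :* Q) refl K p Q ⟩
      K ℚ.* Q ∎

    at-boundary : Φ original A ℚ.+ Φ original A⁺ ℚ.< Φ modified A ℚ.+ Φ modified A⁺
    at-boundary = subst₂ ℚ._<_ (sym Φ-original-pair) (sym Φ-modified-pair)
      (ℚ.*-monoˡ-<-pos Q {{ℚ.positive (0<common e∉A)}} (margin {A = A} (proj₂ (proj₂ bS))))

  paired : (Fin n → Family n) → Subset n → ℚ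
  paired G A = if lookup A e then 0ℚ else Φ G A ℚ.+ Φ G (A [ e ]≔ true)

  paired-≤ : ∀ A → paired original A ℚ.≤ paired modified A
  paired-≤ A with lookup A e in Ae
  ... | true  = ℚ.≤-refl
  ... | false with GStarₐ F e a (truncateAt e A) in bA
  ...   | true  = ℚ.<⇒≤ (at-boundary (lookup≡false⇒∉ Ae) (GStarₐ⁻ bA))
  ...   | false = ℚ.+-mono-≤ (off-boundary ¬bA)
                     (off-boundary (subst (¬_ ∘ IsBoundaryₐ) (sym (truncateAt-[]≔true e A)) ¬bA))
    where
    ¬bA : ¬ IsBoundaryₐ (truncateAt e A)
    ¬bA bA′ = true≢false (GStarₐ⁺ bA′) bA

  averaging : ∀ {A} → e ∉ A → IsBoundaryₐ (truncateAt e A) →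
              ∑∈ ⁅< e ⁆ (λ _ → μ p F) ℚ.< ∑∈ ⁅< e ⁆ (λ i → μ p (Fᵢ F e a i))
  averaging {A} e∉A bA = subst₂ ℚ._<_
    (sym (trans (∑∈-μ original) (∑-pairs e (Φ original))))
    (sym (trans (∑∈-μ modified) (∑-pairs e (Φ modified))))
    (∑-mono-< paired-≤ (∈-allSubsets A) gain)
    where
    gain : paired original A ℚ.< paired modified A
    gain rewrite ∉⇒lookup≡false e∉A = at-boundary e∉A bA

lemma2p25 : ∀ {n : ℕ} (t a : ℕ) (F : Family n) (e : Fin n) →
    NonTrivial F → Monotone F → LeftCompressed F → TIntersecting t F →
    IsExtent F e → 1 < suc (toℕ e) →
    suc (toℕ e) + t ≡ 2 * a →
    (∃ λ S → GStarₐ F e a S ≡ true) →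
    ((i : Fin n) → toℕ i < toℕ e → TIntersecting t (Fᵢ F e a i))
    × (∀ p → 0ℚ <ℚ p →
         p *ℚ ℕ→ℚ (2 * toℕ e) <ℚ ℕ→ℚ (suc (toℕ e)) -ℚ ℕ→ℚ t →
         ∃ λ i → toℕ i < toℕ e × μ p F <ℚ μ p (Fᵢ F e a i))
lemma2p25 t a F e _ mono lc ti (_ , bounded) _ m+t≡2a (S₀ , bS₀) =
  TIntersection.Fᵢ-intersecting t a F e lc ti bounded m+t≡2a , improvement
  where
  open Modification F e a
  open Exchange a F e mono lc bounded using (boundary≡truncateAt)

  bA₀ : IsBoundaryₐ (truncateAt e (⁅< e ⁆ ∩ S₀))
  bA₀ = subst IsBoundaryₐ (sym (boundary≡truncateAt (GStarₐ⁻ bS₀))) (GStarₐ⁻ bS₀)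

  improvement : ∀ p → 0ℚ <ℚ p → p *ℚ ℕ→ℚ (2 * toℕ e) <ℚ ℕ→ℚ (suc (toℕ e)) -ℚ ℕ→ℚ t →
                ∃ λ i → toℕ i < toℕ e × μ p F <ℚ μ p (Fᵢ F e a i)
  improvement p 0<p p-small = Product.map₂ (Product.map₁ ∈⁅<⁆⁻) (∑∈-<⇒∃ ⁅< e ⁆
    (Averaging.averaging t a F e mono lc bounded m+t≡2a p 0<p p<1 p-small (e∉⁅<e⁆∩C {C = S₀}) bA₀))
    where
    p<1 : p ℚ.< 1ℚ
    p<1 = Margin.p<1 t a e m+t≡2a p p-small (proj₂ (proj₂ bA₀))
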